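{- Let $n>2$ and consider the directed circulant graph $C_n^+(1,2)$. For $0<l\le n$, the number of primitive pseudo orbits of length $l$ is \[ PsO(n,l)=\begin{cases}\frac{n}{l}\binom{l}{n-l} & \text{if } l<n,\\ 2 & \text{if } l=n.\end{cases} \]
   Context: $C_n^+(1,2)$ is the directed graph with vertex set $\{0,1,\dots,n-1\}$ (identified with $\mathbb{Z}/n\mathbb{Z}$) whose bonds are $(v,v+1 \bmod n)$ and $(v,v+2\bmod n)$ for every vertex $v$. A circuit of length $l\ge1$ is a sequence of vertices $v_0,\dots,v_l$ with $v_l=v_0$ and each $(v_i,v_{i+1})$ a bond. A periodic orbit is an equivalence class of circuits under cyclic rotation; its length is the length of any of its circuits; it is primitive if it is not a shorter periodic orbit repeated several times. A pseudo orbit is a finite collection of periodic orbits; its length is the sum of the lengths of its periodic orbits. A pseudo orbit is primitive if it consists only of primitive periodic orbits, none of which is repeated in the collection. Convention: $\binom{a}{b}=0$ unless $a,b$ are integers with $0\le b\le a$. -}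

module Defs where

open import Data.Nat using (ℕ; zero; suc; _+_; _*_; _<_; _≤_; NonZero)
open import Data.Nat.DivMod using (_%_; m%n<n)
open import Data.Nat.Divisibility using (_∣_)
open import Data.Fin using (Fin; toℕ; fromℕ<)
open import Data.List using (List; []; _∷_; length; map)
open import Data.Nat.ListAction using (sum)
open import Data.List.Relation.Unary.All using (All)
import Data.List.Relation.Unary.Any
open import Data.List.Relation.Unary.AllPairs using (AllPairs)
open import Data.List.Relation.Binary.Permutation.Homogeneous using (Permutation)
open import Data.Product using (Σ; ∃; _×_; _,_)
open import Data.Sum using (_⊎_)
open import Relation.Nullary using (¬_)
open import Relation.Binary.PropositionalEquality using (_≡_)

-- The directed circulant graph C_n^+(1,2): vertices Fin n ≅ ℤ/nℤ,
-- bonds (v, v+1 mod n) and (v, v+2 mod n).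
Bond : (n : ℕ) .{{_ : NonZero n}} → Fin n → Fin n → Set
Bond n v w = (toℕ w ≡ (toℕ v + 1) % n) ⊎ (toℕ w ≡ (toℕ v + 2) % n)

-- A circuit of length l = suc len-1 ≥ 1: vertices v_0, …, v_{l-1}
-- (with v_l = v_0 implicit), every (v_i, v_{i+1 mod l}) a bond.
record Circuit (n : ℕ) .{{_ : NonZero n}} : Set where
  field
    len-1 : ℕ
    vert  : Fin (suc len-1) → Fin n

  len : ℕ
  len = suc len-1

  at : ℕ → Fin n
  at j = vert (fromℕ< (m%n<n j len))

  field
    bond : ∀ (i : Fin len) → Bond n (vert i) (at (suc (toℕ i)))

open Circuit public

module _ {n : ℕ} .{{_ : NonZero n}} where

  SameOrbit : Circuit n → Circuit n → Set
  SameOrbit c c′ = (len c ≡ len c′) × ∃ λ r → ∀ (j : ℕ) → at c′ j ≡ at c (j + r)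

  IsRepetition : Circuit n → Set
  IsRepetition c = ∃ λ (c′ : Circuit n) →
    (len c′ < len c) × (len c′ ∣ len c) × (∀ (j : ℕ) → at c j ≡ at c′ j)

  PrimitiveOrbit : Circuit n → Set
  PrimitiveOrbit c = ¬ IsRepetition c

  -- A pseudo orbit: a finite collection (multiset) of periodic orbits,
  -- represented by a list of circuit representatives.
  PseudoOrbit : Set
  PseudoOrbit = List (Circuit n)

  SamePseudoOrbit : PseudoOrbit → PseudoOrbit → Set
  SamePseudoOrbit = Permutation SameOrbit

  pseudoLength : PseudoOrbit → ℕ
  pseudoLength γ = sum (map len γ)

  PrimitivePseudoOrbit : PseudoOrbit → Set
  PrimitivePseudoOrbit γ = All PrimitiveOrbit γ × AllPairs (λ c c′ → ¬ SameOrbit c c′) γ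

  -- The primitive pseudo orbits of length l (as equivalence classes) are
  -- counted by N: there is a list of N representatives, each a primitive
  -- pseudo orbit of length l, pairwise distinct as pseudo orbits, and every
  -- primitive pseudo orbit of length l equals one of them.
  NumPrimPseudoOrbits : ℕ → ℕ → Set
  NumPrimPseudoOrbits l N = Σ (List PseudoOrbit) λ L →
      (length L ≡ N)
    × All (λ γ → PrimitivePseudoOrbit γ × (pseudoLength γ ≡ l)) L
    × AllPairs (λ γ δ → ¬ SamePseudoOrbit γ δ) L
    × (∀ (γ : PseudoOrbit) → PrimitivePseudoOrbit γ → pseudoLength γ ≡ l →
         Data.List.Relation.Unary.Any.Any (SamePseudoOrbit γ) L)

{-# OPTIONS --safe #-}

-- A circuit is determined by its start vertex and its word of steps in {1, 2}.  Its
-- displacement (the sum of the steps) is a positive multiple of n lying between its length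
-- and twice its length, so every circuit has length at least n / 2 and a primitive pseudo
-- orbit of length l < n is a single orbit winding once round the cycle.  Such an orbit
-- either visits 0 or jumps over 0 from n − 1; rotating it to start there identifies these
-- orbits with the words of length l summing to n, and the words of length l − 1 summing to
-- n − 2 (prefixed by a 2-step).  There are l C (n − l) + (l − 1) C (n − l − 1) of them, which
-- the absorption identity turns into (n / l) · l C (n − l).  For l = n the only orbit winding
-- once is 0 → 1 → ⋯ → n − 1, and one winding twice has all steps 2: for odd n this is a
-- second primitive orbit, while for even n it is a repetition and its two halves, through the
-- even and through the odd vertices, form the second primitive pseudo orbit.

module Submission where

open import Defs
open import Data.Nat using (ℕ; NonZero; _*_; _∸_; _<_; _≤_; _>_)
open import Data.Nat.Combinatorics using (_C_)
open import Data.Product using (∃; _×_)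
open import Relation.Binary.PropositionalEquality using (_≡_)

open import Data.Nat
open import Data.Nat.Properties
open import Data.Nat.DivMod
open import Data.Nat.Divisibility using (divides; m%n≡0⇒n∣m)
open import Data.Nat.Combinatorics using (nCk+nC[k+1]≡[n+1]C[k+1]; nC1≡n)
open import Data.Nat.Tactic.RingSolver using (solve-∀)
open import Data.Fin using (Fin; toℕ; fromℕ<)
open import Data.Fin.Properties using (toℕ-fromℕ<; fromℕ<-cong; toℕ<n; toℕ-injective)
open import Data.List using (List; []; _∷_; [_]; _++_; map; length)
open import Data.List.Properties using (length-++; length-map)
open import Data.List.Membership.Propositional using (_∈_)
open import Data.List.Membership.Propositional.Properties using (∈-map⁺; ∈-++⁺ˡ; ∈-++⁺ʳ)
open import Data.List.Relation.Unary.All as All using (All; []; _∷_)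
import Data.List.Relation.Unary.All.Properties as All
open import Data.List.Relation.Unary.Any as Any using (Any; here; there)
import Data.List.Relation.Unary.Any.Properties as Any
open import Data.List.Relation.Unary.AllPairs as AllPairs using (AllPairs; []; _∷_)
import Data.List.Relation.Unary.AllPairs.Properties as AllPairs
open import Data.List.Relation.Unary.Unique.Propositional using (Unique)
open import Data.List.Relation.Binary.Pointwise using ([]; _∷_)
import Data.List.Relation.Binary.Permutation.Homogeneous as Permutation
import Data.List.Relation.Binary.Permutation.Setoid.Properties as PermutationProperties
open import Data.Product using (Σ; _,_; proj₁; proj₂)
open import Data.Sum using (_⊎_; inj₁; inj₂)
open import Function using (_∘_)
open import Level using (0ℓ)
open import Relation.Binary.Bundles using (Setoid)
open import Relation.Nullary using (¬_; yes; no; contradiction)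
open import Relation.Binary.PropositionalEquality hiding ([_])
open ≡-Reasoning

-- Arithmetic

sumBelow : (ℕ → ℕ) → ℕ → ℕ
sumBelow f zero    = 0
sumBelow f (suc k) = f 0 + sumBelow (f ∘ suc) k

sumBelow-suc : ∀ f k → sumBelow f (suc k) ≡ sumBelow f k + f k
sumBelow-suc f zero    = +-comm (f 0) 0
sumBelow-suc f (suc k) = trans (cong (f 0 +_) (sumBelow-suc (f ∘ suc) k)) (sym (+-assoc (f 0) _ _))

sumBelow-cong : ∀ {f g} k → (∀ i → i < k → f i ≡ g i) → sumBelow f k ≡ sumBelow g k
sumBelow-cong zero    eq = refl
sumBelow-cong (suc k) eq = cong₂ _+_ (eq 0 z<s) (sumBelow-cong k (λ i i<k → eq (suc i) (s<s i<k)))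

sumBelow-+ : ∀ f a b → sumBelow f (a + b) ≡ sumBelow f a + sumBelow (λ i → f (a + i)) b
sumBelow-+ f zero    b = refl
sumBelow-+ f (suc a) b = trans (cong (f 0 +_) (sumBelow-+ (f ∘ suc) a b)) (sym (+-assoc (f 0) _ _))

k≤sumBelow : ∀ {f} k → (∀ i → i < k → 1 ≤ f i) → k ≤ sumBelow f k
k≤sumBelow zero    _  = z≤n
k≤sumBelow (suc k) ge = +-mono-≤ (ge 0 z<s) (k≤sumBelow k (λ i i<k → ge (suc i) (s<s i<k)))

-- Structural doubling, so that the index of allTwos (suc L) is suc (suc (double L)).
double : ℕ → ℕ
double zero    = 0
double (suc m) = suc (suc (double m))

double≡m+m : ∀ m → double m ≡ m + m
double≡m+m zero    = refl
double≡m+m (suc m) = cong suc (trans (cong suc (double≡m+m m)) (sym (+-suc m m)))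

double-+ : ∀ a b → double (a + b) ≡ double a + double b
double-+ zero    b = refl
double-+ (suc a) b = cong (suc ∘ suc) (double-+ a b)

double-injective : ∀ {a b} → double a ≡ double b → a ≡ b
double-injective {zero}  {zero}  _  = refl
double-injective {suc a} {suc b} eq = cong suc (double-injective (suc-injective (suc-injective eq)))

double-mono-≤ : ∀ {a b} → a ≤ b → double a ≤ double b
double-mono-≤ {zero}  _         = z≤n
double-mono-≤ {suc a} (s≤s a≤b) = s≤s (s≤s (double-mono-≤ a≤b))

double-<-mono : ∀ {a b} → a < b → double a < double b
double-<-mono {zero}  {suc b} _          = z<s
double-<-mono {suc a} {suc b} (s≤s a<b) = s<s (s<s (double-<-mono a<b))

double≢1+double : ∀ a b → double a ≢ suc (double b)
double≢1+double zero          b       ()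
double≢1+double (suc zero)    zero    ()
double≢1+double (suc (suc a)) zero    ()
double≢1+double (suc a)       (suc b) eq = double≢1+double a b (suc-injective (suc-injective eq))

≤-+-tight : ∀ {a b c d} → a ≤ c → b ≤ d → c + d ≤ a + b → a ≡ c × b ≡ d
≤-+-tight {a} {b} {c} {d} a≤c b≤d c+d≤a+b =
    ≤-antisym a≤c (+-cancelʳ-≤ d c a (≤-trans c+d≤a+b (+-monoʳ-≤ a b≤d)))
  , ≤-antisym b≤d (+-cancelˡ-≤ c d b (≤-trans c+d≤a+b (+-monoˡ-≤ b a≤c)))

sumBelow≤double : ∀ {f} k → (∀ i → i < k → f i ≤ 2) → sumBelow f k ≤ double k
sumBelow≤double zero    _  = z≤n
sumBelow≤double (suc k) le = +-mono-≤ (le 0 z<s) (sumBelow≤double k (λ i i<k → le (suc i) (s<s i<k)))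

sumBelow≡double⇒≡2 : ∀ {f} k → (∀ i → i < k → f i ≤ 2) → sumBelow f k ≡ double k → ∀ i → i < k → f i ≡ 2
sumBelow≡double⇒≡2 {f} (suc k) le eq i i<k = go i i<k
  where
    split : f 0 ≡ 2 × sumBelow (f ∘ suc) k ≡ double k
    split = ≤-+-tight (le 0 z<s) (sumBelow≤double k (λ i i<k → le (suc i) (s<s i<k))) (≤-reflexive (sym eq))
    go : ∀ i → i < suc k → f i ≡ 2
    go zero    _         = proj₁ split
    go (suc i) (s≤s i<k) = sumBelow≡double⇒≡2 k (λ i i<k → le (suc i) (s<s i<k)) (proj₂ split) i i<k

even⊎odd : ∀ n → (∃ λ m → n ≡ double m) ⊎ (∃ λ m → n ≡ suc (double m))
even⊎odd zero = inj₁ (0 , refl)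
even⊎odd (suc n) with even⊎odd n
... | inj₁ (m , n≡2m)   = inj₂ (m , cong suc n≡2m)
... | inj₂ (m , n≡2m+1) = inj₁ (suc m , cong suc n≡2m+1)

halves≤ : ∀ {n a b} → n ≤ double a → n ≤ double b → n ≤ a + b
halves≤ {n} {a} {b} n≤2a n≤2b with n ≤? a + b
... | yes n≤a+b = n≤a+b
... | no  n≰a+b = contradiction (≤-trans (+-mono-≤ n≤2a n≤2b) (≤-reflexive (sym (double-+ a b))))
                    (<⇒≱ (≤-trans (double-<-mono (≰⇒> n≰a+b)) (≤-reflexive (double≡m+m n))))

halves-tight : ∀ {n a b r} → n ≤ double a → n ≤ double b → a + (b + r) ≤ n →
               double a ≡ n × double b ≡ n × r ≡ 0
halves-tight {n} {a} {b} {r} n≤2a n≤2b a+b+r≤n = sym (proj₁ tight) , sym (proj₂ tight) , r≡0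
  where
    a+b≤n : a + b ≤ n
    a+b≤n = m+n≤o⇒m≤o (a + b) (≤-trans (≤-reflexive (+-assoc a b r)) a+b+r≤n)
    tight : n ≡ double a × n ≡ double b
    tight = ≤-+-tight n≤2a n≤2b (≤-trans (≤-reflexive (sym (double-+ a b)))
              (≤-trans (double-mono-≤ a+b≤n) (≤-reflexive (double≡m+m n))))
    r≡0 : r ≡ 0
    r≡0 = n≤0⇒n≡0 (+-cancelˡ-≤ (a + b) r 0 (≤-trans (≤-reflexive (+-assoc a b r))
            (≤-trans a+b+r≤n (≤-trans (halves≤ n≤2a n≤2b) (≤-reflexive (sym (+-identityʳ (a + b))))))))

module _ {d : ℕ} .{{_ : NonZero d}} where

  [m+n%d]%d≡[m+n]%d : ∀ m n → (m + n % d) % d ≡ (m + n) % d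
  [m+n%d]%d≡[m+n]%d m n = begin
    (m + n % d) % d          ≡⟨ %-distribˡ-+ m (n % d) d ⟩
    (m % d + n % d % d) % d  ≡⟨ cong (λ z → (m % d + z) % d) (m%n%n≡m%n n d) ⟩
    (m % d + n % d) % d      ≡⟨ %-distribˡ-+ m n d ⟨
    (m + n) % d              ∎

  [m%d+n]%d≡[m+n]%d : ∀ m n → (m % d + n) % d ≡ (m + n) % d
  [m%d+n]%d≡[m+n]%d m n = begin
    (m % d + n) % d  ≡⟨ cong (_% d) (+-comm (m % d) n) ⟩
    (n + m % d) % d  ≡⟨ [m+n%d]%d≡[m+n]%d n m ⟩
    (n + m) % d      ≡⟨ cong (_% d) (+-comm n m) ⟩
    (m + n) % d      ∎

  [m+n]%d≡[m+o]%d⇒n%d≡o%d : ∀ m n o → (m + n) % d ≡ (m + o) % d → n % d ≡ o % d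
  [m+n]%d≡[m+o]%d⇒n%d≡o%d m n o eq = begin
    n % d                          ≡⟨ recover n ⟩
    ((d ∸ m % d) + (m + n) % d) % d ≡⟨ cong (λ z → ((d ∸ m % d) + z) % d) eq ⟩
    ((d ∸ m % d) + (m + o) % d) % d ≡⟨ recover o ⟨
    o % d                          ∎
    where
      arrange : ∀ a b q c d → b + ((a + q * d) + c) ≡ c + (b + a) + q * d
      arrange = solve-∀
      recover : ∀ n → n % d ≡ ((d ∸ m % d) + (m + n) % d) % d
      recover n = sym (begin
        ((d ∸ m % d) + (m + n) % d) % d                   ≡⟨ [m+n%d]%d≡[m+n]%d (d ∸ m % d) (m + n) ⟩
        ((d ∸ m % d) + (m + n)) % d
          ≡⟨ cong (λ z → ((d ∸ m % d) + (z + n)) % d) (m≡m%n+[m/n]*n m d) ⟩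
        ((d ∸ m % d) + ((m % d + m / d * d) + n)) % d     ≡⟨ cong (_% d) (arrange (m % d) (d ∸ m % d) (m / d) n d) ⟩
        (n + ((d ∸ m % d) + m % d) + m / d * d) % d
          ≡⟨ cong (λ z → (n + z + m / d * d) % d) (m∸n+n≡m (m%n≤n m d)) ⟩
        (n + d + m / d * d) % d                           ≡⟨ cong (_% d) (+-assoc n d (m / d * d)) ⟩
        (n + suc (m / d) * d) % d                         ≡⟨ [m+kn]%n≡m%n n (suc (m / d)) d ⟩
        n % d                                             ∎)

  [m+n]%d≡[m+o]%d⇒n≡o : ∀ m {n o} → n < d → o < d → (m + n) % d ≡ (m + o) % d → n ≡ o
  [m+n]%d≡[m+o]%d⇒n≡o m {n} {o} n<d o<d eq = begin
    n      ≡⟨ m<n⇒m%n≡m n<d ⟨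
    n % d  ≡⟨ [m+n]%d≡[m+o]%d⇒n%d≡o%d m n o eq ⟩
    o % d  ≡⟨ m<n⇒m%n≡m o<d ⟩
    o      ∎

  %≡0⇒≡0⊎≡d⊎≡d+d : ∀ x → x % d ≡ 0 → x ≤ d + d → x ≡ 0 ⊎ x ≡ d ⊎ x ≡ d + d
  %≡0⇒≡0⊎≡d⊎≡d+d x x%d≡0 x≤d+d with m%n≡0⇒n∣m x d x%d≡0
  ... | divides 0 eq = inj₁ eq
  ... | divides 1 eq = inj₂ (inj₁ (trans eq (+-identityʳ d)))
  ... | divides 2 eq = inj₂ (inj₂ (trans eq (cong (d +_) (+-identityʳ d))))
  ... | divides (suc (suc (suc q))) eq = contradiction (subst (_≤ d + d) eq x≤d+d) (<⇒≱ d+d<3d)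
    where
      d+d<3d : d + d < d + (d + (d + q * d))
      d+d<3d = ≤-trans (m<m+n (d + d) (≤-trans (>-nonZero⁻¹ d) (m≤m+n d (q * d)))) (≤-reflexive (+-assoc d d _))

[k+1]*[n+1]C[k+1]≡[n+1]*nCk : ∀ n k → suc k * (suc n C suc k) ≡ suc n * (n C k)
[k+1]*[n+1]C[k+1]≡[n+1]*nCk zero    zero    = refl
[k+1]*[n+1]C[k+1]≡[n+1]*nCk zero    (suc k) = *-zeroʳ (2 + k)
[k+1]*[n+1]C[k+1]≡[n+1]*nCk (suc n) zero    =
  trans (+-identityʳ _) (trans (nC1≡n (2 + n)) (sym (*-identityʳ (2 + n))))
[k+1]*[n+1]C[k+1]≡[n+1]*nCk (suc n) (suc k) = begin
  (2 + k) * ((2 + n) C (2 + k))    ≡⟨ cong ((2 + k) *_) (nCk+nC[k+1]≡[n+1]C[k+1] (suc n) (suc k)) ⟨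
  (2 + k) * (X + Y)                ≡⟨ rearrange k X Y ⟩
  X + (suc k * X + (2 + k) * Y)    ≡⟨ cong₂ (λ u w → X + (u + w)) ([k+1]*[n+1]C[k+1]≡[n+1]*nCk n k)
                                                                ([k+1]*[n+1]C[k+1]≡[n+1]*nCk n (suc k)) ⟩
  X + (suc n * A + suc n * B)      ≡⟨ cong (X +_) (*-distribˡ-+ (suc n) A B) ⟨
  X + suc n * (A + B)              ≡⟨ cong (λ z → X + suc n * z) (nCk+nC[k+1]≡[n+1]C[k+1] n k) ⟩
  (2 + n) * X                      ∎
  where
    X = suc n C suc k
    Y = suc n C (2 + k)
    A = n C k
    B = n C suc k
    rearrange : ∀ k X Y → (2 + k) * (X + Y) ≡ X + (suc k * X + (2 + k) * Y)
    rearrange = solve-∀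

absorption-+ : ∀ a b → suc a * (suc a C suc b + a C b) ≡ (suc a + suc b) * (suc a C suc b)
absorption-+ a b = begin
  suc a * (X + a C b)          ≡⟨ *-distribˡ-+ (suc a) X (a C b) ⟩
  suc a * X + suc a * (a C b)  ≡⟨ cong (suc a * X +_) ([k+1]*[n+1]C[k+1]≡[n+1]*nCk a b) ⟨
  suc a * X + suc b * X        ≡⟨ *-distribʳ-+ X (suc a) (suc b) ⟨
  (suc a + suc b) * X          ∎
  where X = suc a C suc b

upcrossing : ∀ {m} (f : ℕ → ℕ) → f 0 < m → ∀ k → m ≤ f k → ∃ λ j → f j < m × m ≤ f (suc j)
upcrossing f f0<m zero    m≤f0 = contradiction m≤f0 (<⇒≱ f0<m)
upcrossing {m} f f0<m (suc k) m≤fk+1 with m ≤? f k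
... | yes m≤fk = upcrossing f f0<m k m≤fk
... | no  m≰fk = k , ≰⇒> m≰fk , m≤fk+1

-- Words of steps

infixr 5 1∷_ 2∷_

data Steps : ℕ → ℕ → Set where
  []  : Steps 0 0
  1∷_ : ∀ {L s} → Steps L s → Steps (suc L) (1 + s)
  2∷_ : ∀ {L s} → Steps L s → Steps (suc L) (2 + s)

-- step σ i is the i-th entry of σ, and 0 (junk) for i ≥ L.
step : ∀ {L s} → Steps L s → ℕ → ℕ
step []     _       = 0
step (1∷ σ) zero    = 1
step (2∷ σ) zero    = 2
step (1∷ σ) (suc i) = step σ i
step (2∷ σ) (suc i) = step σ i

sumBelow-step : ∀ {L s} (σ : Steps L s) → sumBelow (step σ) L ≡ s
sumBelow-step []     = refl
sumBelow-step (1∷ σ) = cong (1 +_) (sumBelow-step σ)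
sumBelow-step (2∷ σ) = cong (2 +_) (sumBelow-step σ)

sumBelow-step< : ∀ {L s} (σ : Steps L s) {i} → i < L → sumBelow (step σ) i < s
sumBelow-step< (1∷ σ) {zero}  _         = z<s
sumBelow-step< (2∷ σ) {zero}  _         = z<s
sumBelow-step< (1∷ σ) {suc i} (s≤s i<L) = s<s (sumBelow-step< σ i<L)
sumBelow-step< (2∷ σ) {suc i} (s≤s i<L) = s<s (s<s (sumBelow-step< σ i<L))

i≤sumBelow-step : ∀ {L s} (σ : Steps L s) {i} → i ≤ L → i ≤ sumBelow (step σ) i
i≤sumBelow-step σ      {zero}  _         = z≤n
i≤sumBelow-step (1∷ σ) {suc i} (s≤s i≤L) = s≤s (i≤sumBelow-step σ i≤L)
i≤sumBelow-step (2∷ σ) {suc i} (s≤s i≤L) = s≤s (m≤n⇒m≤1+n (i≤sumBelow-step σ i≤L))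

step∈12 : ∀ {L s} (σ : Steps L s) {i} → i < L → step σ i ≡ 1 ⊎ step σ i ≡ 2
step∈12 (1∷ σ) {zero}  _         = inj₁ refl
step∈12 (2∷ σ) {zero}  _         = inj₂ refl
step∈12 (1∷ σ) {suc i} (s≤s i<L) = step∈12 σ i<L
step∈12 (2∷ σ) {suc i} (s≤s i<L) = step∈12 σ i<L

length≤total : ∀ {L s} → Steps L s → L ≤ s
length≤total []     = z≤n
length≤total (1∷ σ) = s≤s (length≤total σ)
length≤total (2∷ σ) = s≤s (m≤n⇒m≤1+n (length≤total σ))

Steps-ext : ∀ {L s} (σ τ : Steps L s) → (∀ i → i < L → step σ i ≡ step τ i) → σ ≡ τ
Steps-ext []     []     _  = refl
Steps-ext (1∷ σ) (1∷ τ) eq = cong 1∷_ (Steps-ext σ τ (λ i i<L → eq (suc i) (s<s i<L)))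
Steps-ext (2∷ σ) (2∷ τ) eq = cong 2∷_ (Steps-ext σ τ (λ i i<L → eq (suc i) (s<s i<L)))
Steps-ext (1∷ σ) (2∷ τ) eq with () ← eq 0 z<s
Steps-ext (2∷ σ) (1∷ τ) eq with () ← eq 0 z<s

tabulateSteps : ∀ L (f : ℕ → ℕ) → (∀ i → i < L → f i ≡ 1 ⊎ f i ≡ 2) →
           ∃ λ s → Σ (Steps L s) λ σ → ∀ i → i < L → step σ i ≡ f i
tabulateSteps zero    f f∈12 = 0 , [] , λ _ ()
tabulateSteps (suc L) f f∈12 with tabulateSteps L (f ∘ suc) (λ i i<L → f∈12 (suc i) (s<s i<L)) | f∈12 0 z<s
... | s , σ , eq | inj₁ f0≡1 = 1 + s , 1∷ σ , λ { zero _ → sym f0≡1 ; (suc i) (s≤s i<L) → eq i i<L }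
... | s , σ , eq | inj₂ f0≡2 = 2 + s , 2∷ σ , λ { zero _ → sym f0≡2 ; (suc i) (s≤s i<L) → eq i i<L }

allOnes : ∀ L → Steps L L
allOnes zero    = []
allOnes (suc L) = 1∷ allOnes L

step-allOnes : ∀ L {i} → i < L → step (allOnes L) i ≡ 1
step-allOnes (suc L) {zero}  _         = refl
step-allOnes (suc L) {suc i} (s≤s i<L) = step-allOnes L i<L

Steps-L-L≡allOnes : ∀ {L} (σ : Steps L L) → σ ≡ allOnes L
Steps-L-L≡allOnes []     = refl
Steps-L-L≡allOnes (1∷ σ) = cong 1∷_ (Steps-L-L≡allOnes σ)
Steps-L-L≡allOnes (2∷ σ) = contradiction (length≤total σ) (<-irrefl refl)

allTwos : ∀ L → Steps L (double L)
allTwos zero    = []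
allTwos (suc L) = 2∷ allTwos L

step-allTwos : ∀ L {i} → i < L → step (allTwos L) i ≡ 2
step-allTwos (suc L) {zero}  _         = refl
step-allTwos (suc L) {suc i} (s≤s i<L) = step-allTwos L i<L

sumBelow-allTwos : ∀ L {i} → i ≤ L → sumBelow (step (allTwos L)) i ≡ double i
sumBelow-allTwos L       {zero}  _         = refl
sumBelow-allTwos (suc L) {suc i} (s≤s i≤L) = cong (2 +_) (sumBelow-allTwos L i≤L)

allSteps : ∀ L s → List (Steps L s)
allSteps zero    zero          = [] ∷ []
allSteps zero    (suc s)       = []
allSteps (suc L) zero          = []
allSteps (suc L) (suc zero)    = map 1∷_ (allSteps L 0)
allSteps (suc L) (suc (suc s)) = map 1∷_ (allSteps L (suc s)) ++ map 2∷_ (allSteps L s)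

∈-allSteps : ∀ {L s} (σ : Steps L s) → σ ∈ allSteps L s
∈-allSteps []                  = here refl
∈-allSteps (1∷_ {s = zero}  σ) = ∈-map⁺ 1∷_ (∈-allSteps σ)
∈-allSteps (1∷_ {s = suc s} σ) = ∈-++⁺ˡ (∈-map⁺ 1∷_ (∈-allSteps σ))
∈-allSteps (2∷_ {L} {s} σ)     = ∈-++⁺ʳ (map 1∷_ (allSteps L (suc s))) (∈-map⁺ 2∷_ (∈-allSteps σ))

1∷-injective : ∀ {L s} {σ τ : Steps L s} → 1∷ σ ≡ 1∷ τ → σ ≡ τ
1∷-injective refl = refl

2∷-injective : ∀ {L s} {σ τ : Steps L s} → 2∷ σ ≡ 2∷ τ → σ ≡ τ
2∷-injective refl = refl

allSteps-unique : ∀ L s → Unique (allSteps L s)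
allSteps-unique zero    zero          = [] ∷ []
allSteps-unique zero    (suc s)       = []
allSteps-unique (suc L) zero          = []
allSteps-unique (suc L) (suc zero)    =
  AllPairs.map⁺ (AllPairs.map (λ σ≢τ → σ≢τ ∘ 1∷-injective) (allSteps-unique L 0))
allSteps-unique (suc L) (suc (suc s)) = AllPairs.++⁺
  (AllPairs.map⁺ (AllPairs.map (λ σ≢τ → σ≢τ ∘ 1∷-injective) (allSteps-unique L (suc s))))
  (AllPairs.map⁺ (AllPairs.map (λ σ≢τ → σ≢τ ∘ 2∷-injective) (allSteps-unique L s)))
  (All.map⁺ (All.tabulate (λ _ → All.map⁺ (All.tabulate (λ _ ())))))

length-allSteps-suc : ∀ L s → length (allSteps (suc L) (2 + s)) ≡ length (allSteps L (suc s)) + length (allSteps L s)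
length-allSteps-suc L s = trans (length-++ (map 1∷_ (allSteps L (suc s))))
  (cong₂ _+_ (length-map 1∷_ (allSteps L (suc s))) (length-map 2∷_ (allSteps L s)))

length-allSteps-< : ∀ L s → s < L → length (allSteps L s) ≡ 0
length-allSteps-< (suc L) zero          _         = refl
length-allSteps-< (suc L) (suc zero)    (s≤s 1≤L) = trans (length-map 1∷_ (allSteps L 0)) (length-allSteps-< L 0 1≤L)
length-allSteps-< (suc L) (suc (suc s)) (s≤s s<L) = trans (length-allSteps-suc L s)
  (cong₂ _+_ (length-allSteps-< L (suc s) s<L) (length-allSteps-< L s (<-trans (n<1+n s) s<L)))

length-allSteps : ∀ L s → L ≤ s → length (allSteps L s) ≡ L C (s ∸ L)
length-allSteps zero    zero          _         = refl
length-allSteps zero    (suc s)       _         = refl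
length-allSteps (suc L) (suc zero)    (s≤s z≤n) = refl
length-allSteps (suc L) (suc (suc s)) (s≤s L≤1+s) with L ≤? s
... | yes L≤s = begin
  length (allSteps (suc L) (2 + s))                    ≡⟨ length-allSteps-suc L s ⟩
  length (allSteps L (suc s)) + length (allSteps L s)  ≡⟨ cong₂ _+_ (length-allSteps L (suc s) L≤1+s)
                                                                     (length-allSteps L s L≤s) ⟩
  L C (suc s ∸ L) + L C (s ∸ L)                        ≡⟨ cong (λ k → L C k + L C (s ∸ L)) (+-∸-assoc 1 L≤s) ⟩
  L C suc (s ∸ L) + L C (s ∸ L)                        ≡⟨ +-comm (L C suc (s ∸ L)) _ ⟩
  L C (s ∸ L) + L C suc (s ∸ L)                        ≡⟨ nCk+nC[k+1]≡[n+1]C[k+1] L (s ∸ L) ⟩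
  suc L C suc (s ∸ L)                                  ≡⟨ cong (suc L C_) (+-∸-assoc 1 L≤s) ⟨
  suc L C (suc s ∸ L)                                  ∎
... | no L≰s with refl ← ≤-antisym L≤1+s (≰⇒> L≰s) = begin
  length (allSteps (suc L) (2 + s))              ≡⟨ length-allSteps-suc L s ⟩
  length (allSteps L L) + length (allSteps L s)  ≡⟨ cong₂ _+_ (length-allSteps L L ≤-refl)
                                                               (length-allSteps-< L s ≤-refl) ⟩
  L C (L ∸ L) + 0                                ≡⟨ cong (λ k → L C k + 0) (n∸n≡0 L) ⟩
  1                                              ≡⟨ cong (suc L C_) (n∸n≡0 L) ⟨
  suc L C (L ∸ L)                                ∎

sumBelow≢1 : ∀ {L s} (σ : Steps L s) → step σ 0 ≡ 2 → ∀ k → sumBelow (step σ) k ≢ 1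
sumBelow≢1 (2∷ σ) _ zero    ()
sumBelow≢1 (2∷ σ) _ (suc k) ()

-- Circuits of C_n^+(1,2)

module _ {n : ℕ} .{{_ : NonZero n}} where

  bondLength : {v w : Fin n} → Bond n v w → ℕ
  bondLength (inj₁ _) = 1
  bondLength (inj₂ _) = 2

  toℕ-bond : {v w : Fin n} (b : Bond n v w) → toℕ w ≡ (toℕ v + bondLength b) % n
  toℕ-bond (inj₁ eq) = eq
  toℕ-bond (inj₂ eq) = eq

  stepAt : Circuit n → ℕ → ℕ
  stepAt c j = bondLength (bond c (fromℕ< (m%n<n j (len c))))

  stepAt∈12 : ∀ c j → stepAt c j ≡ 1 ⊎ stepAt c j ≡ 2
  stepAt∈12 c j with bond c (fromℕ< (m%n<n j (len c)))
  ... | inj₁ _ = inj₁ refl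
  ... | inj₂ _ = inj₂ refl

  1≤stepAt : ∀ c j → 1 ≤ stepAt c j
  1≤stepAt c j with stepAt∈12 c j
  ... | inj₁ eq = ≤-reflexive (sym eq)
  ... | inj₂ eq = ≤-trans (s≤s z≤n) (≤-reflexive (sym eq))

  stepAt≤2 : ∀ c j → stepAt c j ≤ 2
  stepAt≤2 c j with stepAt∈12 c j
  ... | inj₁ eq = ≤-trans (≤-reflexive eq) (s≤s z≤n)
  ... | inj₂ eq = ≤-reflexive eq

  at-cong-% : ∀ c j k → j % len c ≡ k % len c → at c j ≡ at c k
  at-cong-% c j k eq = cong (vert c) (fromℕ<-cong _ _ eq _ _)

  stepAt-cong-% : ∀ c j k → j % len c ≡ k % len c → stepAt c j ≡ stepAt c k
  stepAt-cong-% c j k eq = cong (bondLength ∘ bond c) (fromℕ<-cong _ _ eq _ _)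

  at-len : ∀ c → at c (len c) ≡ at c 0
  at-len c = at-cong-% c (len c) 0 (n%n≡0 (len c))

  toℕ-at-suc : ∀ c j → toℕ (at c (suc j)) ≡ (toℕ (at c j) + stepAt c j) % n
  toℕ-at-suc c j = trans (cong toℕ (at-cong-% c (suc j) (suc (toℕ i)) j+1≡i+1)) (toℕ-bond (bond c i))
    where
      i = fromℕ< (m%n<n j (len c))
      j+1≡i+1 : suc j % len c ≡ suc (toℕ i) % len c
      j+1≡i+1 = trans (sym ([m+n%d]%d≡[m+n]%d {len c} 1 j))
                      (cong (λ z → suc z % len c) (sym (toℕ-fromℕ< (m%n<n j (len c)))))

  %-recurrence-unique : ∀ (x y st : ℕ → ℕ) → x 0 ≡ y 0 →
                        (∀ j → x (suc j) ≡ (x j + st j) % n) → (∀ j → y (suc j) ≡ (y j + st j) % n) →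
                        ∀ j → x j ≡ y j
  %-recurrence-unique x y st x0≡y0 x-rec y-rec zero    = x0≡y0
  %-recurrence-unique x y st x0≡y0 x-rec y-rec (suc j) = begin
    x (suc j)         ≡⟨ x-rec j ⟩
    (x j + st j) % n  ≡⟨ cong (λ z → (z + st j) % n) (%-recurrence-unique x y st x0≡y0 x-rec y-rec j) ⟩
    (y j + st j) % n  ≡⟨ y-rec j ⟨
    y (suc j)         ∎

  toℕ≡[toℕ+0]%n : (v : Fin n) → toℕ v ≡ (toℕ v + 0) % n
  toℕ≡[toℕ+0]%n v = trans (sym (m<n⇒m%n≡m (toℕ<n v))) (cong (_% n) (sym (+-identityʳ (toℕ v))))

  lifted : Circuit n → ℕ → ℕ
  lifted c j = toℕ (at c 0) + sumBelow (stepAt c) j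

  lifted-suc : ∀ c j → lifted c (suc j) ≡ lifted c j + stepAt c j
  lifted-suc c j = trans (cong (toℕ (at c 0) +_) (sumBelow-suc (stepAt c) j)) (sym (+-assoc (toℕ (at c 0)) _ _))

  toℕ-at : ∀ c j → toℕ (at c j) ≡ lifted c j % n
  toℕ-at c = %-recurrence-unique (toℕ ∘ at c) (λ j → lifted c j % n) (stepAt c)
               (toℕ≡[toℕ+0]%n (at c 0)) (toℕ-at-suc c) lifted-rec
    where
      lifted-rec : ∀ j → lifted c (suc j) % n ≡ (lifted c j % n + stepAt c j) % n
      lifted-rec j = trans (cong (_% n) (lifted-suc c j)) (sym ([m%d+n]%d≡[m+n]%d (lifted c j) (stepAt c j)))

  displacement : Circuit n → ℕ
  displacement c = sumBelow (stepAt c) (len c)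

  displacement%n≡0 : ∀ c → displacement c % n ≡ 0
  displacement%n≡0 c =
    trans ([m+n]%d≡[m+o]%d⇒n%d≡o%d (toℕ (at c 0)) (displacement c) 0 returns) (m<n⇒m%n≡m (>-nonZero⁻¹ n))
    where
      returns : (toℕ (at c 0) + displacement c) % n ≡ (toℕ (at c 0) + 0) % n
      returns = trans (sym (toℕ-at c (len c))) (trans (cong toℕ (at-len c)) (toℕ≡[toℕ+0]%n (at c 0)))

  len≤displacement : ∀ c → len c ≤ displacement c
  len≤displacement c = k≤sumBelow (len c) (λ j _ → 1≤stepAt c j)

  displacement≤double-len : ∀ c → displacement c ≤ double (len c)
  displacement≤double-len c = sumBelow≤double (len c) (λ j _ → stepAt≤2 c j)

  n≤displacement : ∀ c → n ≤ displacement c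
  n≤displacement c with displacement c <? n
  ... | no  D≮n = ≮⇒≥ D≮n
  ... | yes D<n = contradiction (trans (sym (m<n⇒m%n≡m D<n)) (displacement%n≡0 c))
                                (>⇒≢ (≤-trans (s≤s z≤n) (len≤displacement c)))

  n≤double-len : ∀ c → n ≤ double (len c)
  n≤double-len c = ≤-trans (n≤displacement c) (displacement≤double-len c)

  displacement≡n⊎n+n : ∀ c → len c ≤ n → displacement c ≡ n ⊎ displacement c ≡ n + n
  displacement≡n⊎n+n c len≤n with %≡0⇒≡0⊎≡d⊎≡d+d (displacement c) (displacement%n≡0 c) D≤n+n
    where D≤n+n = ≤-trans (displacement≤double-len c) (≤-trans (double-mono-≤ len≤n) (≤-reflexive (double≡m+m n)))
  ... | inj₁ D≡0 = contradiction D≡0 (>⇒≢ (≤-trans (>-nonZero⁻¹ n) (n≤displacement c)))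
  ... | inj₂ D≡n⊎n+n = D≡n⊎n+n

  displacement≡n : ∀ c → len c < n → displacement c ≡ n
  displacement≡n c len<n with displacement≡n⊎n+n c (<⇒≤ len<n)
  ... | inj₁ D≡n   = D≡n
  ... | inj₂ D≡n+n = contradiction D≡n+n (<⇒≢ (≤-trans (s≤s (displacement≤double-len c))
                                                       (≤-trans (double-<-mono len<n) (≤-reflexive (double≡m+m n)))))

  displacement≡double⇒stepAt≡2 : ∀ c → displacement c ≡ double (len c) → ∀ j → stepAt c j ≡ 2
  displacement≡double⇒stepAt≡2 c D≡2L j = trans (stepAt-cong-% c j (j % len c) (sym (m%n%n≡m%n j (len c))))
    (sumBelow≡double⇒≡2 (len c) (λ i _ → stepAt≤2 c i) D≡2L (j % len c) (m%n<n j (len c)))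

  double-len≤n⇒stepAt≡2 : ∀ c → double (len c) ≤ n → ∀ j → stepAt c j ≡ 2
  double-len≤n⇒stepAt≡2 c 2L≤n = displacement≡double⇒stepAt≡2 c
    (≤-antisym (displacement≤double-len c) (≤-trans 2L≤n (n≤displacement c)))

  SameOrbit-refl : ∀ {c} → SameOrbit c c
  SameOrbit-refl {c} = refl , 0 , λ j → cong (at c) (sym (+-identityʳ j))

  SameOrbit-sym : ∀ {c d} → SameOrbit c d → SameOrbit d c
  -- Rotating by r · (len c − 1) undoes the rotation by r, as r · len c ≡ 0 modulo len c.
  SameOrbit-sym {c} {d} (lc≡ld , r , d≡c+r) = sym lc≡ld , r * len-1 c , λ j → sym (begin
    at d (j + r * len-1 c)      ≡⟨ d≡c+r (j + r * len-1 c) ⟩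
    at c (j + r * len-1 c + r)  ≡⟨ cong (at c) (rearrange j r (len-1 c)) ⟩
    at c (j + r * len c)        ≡⟨ at-cong-% c (j + r * len c) j ([m+kn]%n≡m%n j r (len c)) ⟩
    at c j                      ∎)
    where
      rearrange : ∀ j r L → j + r * L + r ≡ j + r * suc L
      rearrange = solve-∀

  SameOrbit-trans : ∀ {c d e} → SameOrbit c d → SameOrbit d e → SameOrbit c e
  SameOrbit-trans {c} (lc≡ld , r , d≡c+r) (ld≡le , r′ , e≡d+r′) = trans lc≡ld ld≡le , r′ + r , λ j →
    trans (e≡d+r′ j) (trans (d≡c+r (j + r′)) (cong (at c) (+-assoc j r′ r)))

  SameOrbit-byShift : ∀ c d r → len c ≡ len d → (∀ j → stepAt d j ≡ stepAt c (j + r)) →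
                      toℕ (at d 0) ≡ toℕ (at c r) → SameOrbit c d
  SameOrbit-byShift c d r lc≡ld steps≡ d0≡cr = lc≡ld , r , λ j → toℕ-injective
    (%-recurrence-unique (toℕ ∘ at d) (λ j → toℕ (at c (j + r))) (stepAt d) d0≡cr (toℕ-at-suc d)
      (λ j → trans (toℕ-at-suc c (j + r)) (cong (λ z → (toℕ (at c (j + r)) + z) % n) (sym (steps≡ j)))) j)

  displacement-shift : ∀ c r → sumBelow (λ i → stepAt c (i + r)) (len c) ≡ displacement c
  displacement-shift c r = +-cancelˡ-≡ (sumBelow st r) _ _ (begin
    sumBelow st r + sumBelow (λ i → st (i + r)) L
      ≡⟨ cong (sumBelow st r +_) (sumBelow-cong L (λ i _ → cong st (+-comm i r))) ⟩
    sumBelow st r + sumBelow (λ i → st (r + i)) L ≡⟨ sumBelow-+ st r L ⟨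
    sumBelow st (r + L)                           ≡⟨ cong (sumBelow st) (+-comm r L) ⟩
    sumBelow st (L + r)                           ≡⟨ sumBelow-+ st L r ⟩
    sumBelow st L + sumBelow (λ i → st (L + i)) r ≡⟨ cong (sumBelow st L +_) (sumBelow-cong r (λ i _ → periodic i)) ⟩
    sumBelow st L + sumBelow st r                 ≡⟨ +-comm (sumBelow st L) _ ⟩
    sumBelow st r + sumBelow st L                 ∎)
    where
      st = stepAt c
      L = len c
      periodic : ∀ i → st (L + i) ≡ st i
      periodic i = stepAt-cong-% c (L + i) i (trans (cong (_% L) (+-comm L i)) ([m+n]%n≡m%n i L))

  bondOfLength : {v w : Fin n} (k : ℕ) → k ≡ 1 ⊎ k ≡ 2 → toℕ w ≡ (toℕ v + k) % n →
                 Σ (Bond n v w) λ b → bondLength b ≡ k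
  bondOfLength _ (inj₁ refl) eq = inj₁ eq , refl
  bondOfLength _ (inj₂ refl) eq = inj₂ eq , refl

  module _ {L s} (v : ℕ) (σ : Steps (suc L) s) (closes : (v + s) % n ≡ v % n) where

    position : ℕ → Fin n
    position k = fromℕ< (m%n<n (v + sumBelow (step σ) k) n)

    toℕ-position-suc : ∀ k → k < suc L → toℕ (position (suc k % suc L)) ≡ (toℕ (position k) + step σ k) % n
    toℕ-position-suc k k<1+L = begin
      toℕ (position (suc k % suc L))                 ≡⟨ toℕ-fromℕ< _ ⟩
      (v + sumBelow (step σ) (suc k % suc L)) % n    ≡⟨ wrap (m<1+n⇒m<n∨m≡n k<1+L) ⟩
      (v + sumBelow (step σ) (suc k)) % n            ≡⟨ cong (λ z → (v + z) % n) (sumBelow-suc (step σ) k) ⟩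
      (v + (sumBelow (step σ) k + step σ k)) % n     ≡⟨ cong (_% n) (+-assoc v _ _) ⟨
      (v + sumBelow (step σ) k + step σ k) % n       ≡⟨ [m%d+n]%d≡[m+n]%d (v + sumBelow (step σ) k) (step σ k) ⟨
      ((v + sumBelow (step σ) k) % n + step σ k) % n ≡⟨ cong (λ z → (z + step σ k) % n) (toℕ-fromℕ< _) ⟨
      (toℕ (position k) + step σ k) % n              ∎
      where
        wrap : k < L ⊎ k ≡ L → (v + sumBelow (step σ) (suc k % suc L)) % n ≡ (v + sumBelow (step σ) (suc k)) % n
        wrap (inj₁ k<L)  = cong (λ z → (v + sumBelow (step σ) z) % n) (m<n⇒m%n≡m (s≤s k<L))
        wrap (inj₂ refl) = begin
          (v + sumBelow (step σ) (suc L % suc L)) % n ≡⟨ cong (λ z → (v + sumBelow (step σ) z) % n) (n%n≡0 (suc L)) ⟩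
          (v + 0) % n                                 ≡⟨ cong (_% n) (+-identityʳ v) ⟩
          v % n                                       ≡⟨ closes ⟨
          (v + s) % n                                 ≡⟨ cong (λ z → (v + z) % n) (sumBelow-step σ) ⟨
          (v + sumBelow (step σ) (suc L)) % n         ∎

    private
      bondAt : (i : Fin (suc L)) →
               Σ (Bond n (position (toℕ i)) (position (toℕ (fromℕ< (m%n<n (suc (toℕ i)) (suc L))))))
                 λ b → bondLength b ≡ step σ (toℕ i)
      bondAt i = bondOfLength (step σ (toℕ i)) (step∈12 σ (toℕ<n i))
        (trans (cong (toℕ ∘ position) (toℕ-fromℕ< (m%n<n (suc (toℕ i)) (suc L))))
               (toℕ-position-suc (toℕ i) (toℕ<n i)))

    fromSteps : Circuit n
    fromSteps = record { len-1 = L ; vert = position ∘ toℕ ; bond = proj₁ ∘ bondAt }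

    toℕ-at-fromSteps : ∀ j → toℕ (at fromSteps j) ≡ (v + sumBelow (step σ) (j % suc L)) % n
    toℕ-at-fromSteps j = trans (toℕ-fromℕ< (m%n<n (v + sumBelow (step σ) (toℕ i)) n))
                               (cong (λ z → (v + sumBelow (step σ) z) % n) (toℕ-fromℕ< (m%n<n j (suc L))))
      where i = fromℕ< (m%n<n j (suc L))

    stepAt-fromSteps : ∀ j → stepAt fromSteps j ≡ step σ (j % suc L)
    stepAt-fromSteps j =
      trans (proj₂ (bondAt (fromℕ< (m%n<n j (suc L))))) (cong (step σ) (toℕ-fromℕ< (m%n<n j (suc L))))

    -- A shorter period k would make the partial sum of σ up to k a positive multiple of n below s ≤ n.
    fromSteps-primitive : s ≤ n → PrimitiveOrbit fromSteps
    fromSteps-primitive s≤n (c′ , k<L , _ , at≡at′) =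
      contradiction partial≡0 (>⇒≢ (≤-trans (s≤s z≤n) (i≤sumBelow-step σ (<⇒≤ k<L))))
      where
        k = len c′
        returns : (v + sumBelow (step σ) k) % n ≡ (v + 0) % n
        returns = begin
          (v + sumBelow (step σ) k) % n            ≡⟨ cong (λ z → (v + sumBelow (step σ) z) % n) (m<n⇒m%n≡m k<L) ⟨
          (v + sumBelow (step σ) (k % suc L)) % n  ≡⟨ toℕ-at-fromSteps k ⟨
          toℕ (at fromSteps k)
            ≡⟨ cong toℕ (trans (at≡at′ k) (trans (at-len c′) (sym (at≡at′ 0)))) ⟩
          toℕ (at fromSteps 0)                     ≡⟨ toℕ-at-fromSteps 0 ⟩
          (v + 0) % n                              ∎
        partial≡0 : sumBelow (step σ) k ≡ 0
        partial≡0 = [m+n]%d≡[m+o]%d⇒n≡o v (≤-trans (sumBelow-step< σ k<L) s≤n) (>-nonZero⁻¹ n) returns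

  SameOrbit-stepAt : 2 < n → ∀ {c d} (same : SameOrbit c d) → ∀ j → stepAt d j ≡ stepAt c (j + proj₁ (proj₂ same))
  SameOrbit-stepAt 2<n {c} {d} (_ , r , d≡c+r) j =
    [m+n]%d≡[m+o]%d⇒n≡o (toℕ (at d j)) (step<n d j) (step<n c (j + r)) (begin
    (toℕ (at d j) + stepAt d j) % n              ≡⟨ toℕ-at-suc d j ⟨
    toℕ (at d (suc j))                           ≡⟨ cong toℕ (d≡c+r (suc j)) ⟩
    toℕ (at c (suc j + r))                       ≡⟨ toℕ-at-suc c (j + r) ⟩
    (toℕ (at c (j + r)) + stepAt c (j + r)) % n  ≡⟨ cong (λ z → (toℕ z + stepAt c (j + r)) % n) (d≡c+r j) ⟨
    (toℕ (at d j) + stepAt c (j + r)) % n        ∎)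
    where
      step<n : ∀ c j → stepAt c j < n
      step<n c j = ≤-trans (s≤s (stepAt≤2 c j)) 2<n

  windOnce : ∀ {L} → ℕ → Steps (suc L) n → Circuit n
  windOnce v σ = fromSteps v σ ([m+n]%n≡m%n v n)

  windOnce-primitive : ∀ {L} v (σ : Steps (suc L) n) → PrimitiveOrbit (windOnce v σ)
  windOnce-primitive v σ = fromSteps-primitive v σ ([m+n]%n≡m%n v n) ≤-refl

  windOnce-injective : 2 < n → ∀ {L} v (σ τ : Steps (suc L) n) →
                       SameOrbit (windOnce v σ) (windOnce v τ) → σ ≡ τ
  windOnce-injective 2<n {L} v σ τ same@(_ , r , τ≡σ+r) = Steps-ext σ τ step≡
    where
      k = r % suc L
      partial≡0 : sumBelow (step σ) k ≡ 0
      partial≡0 = [m+n]%d≡[m+o]%d⇒n≡o v (sumBelow-step< σ (m%n<n r (suc L))) (>-nonZero⁻¹ n) (begin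
        (v + sumBelow (step σ) k) % n  ≡⟨ toℕ-at-fromSteps v σ ([m+n]%n≡m%n v n) r ⟨
        toℕ (at (windOnce v σ) r)      ≡⟨ cong toℕ (τ≡σ+r 0) ⟨
        toℕ (at (windOnce v τ) 0)      ≡⟨ toℕ-at-fromSteps v τ ([m+n]%n≡m%n v n) 0 ⟩
        (v + 0) % n                    ∎)
      k≡0 : k ≡ 0
      k≡0 = n≤0⇒n≡0 (≤-trans (i≤sumBelow-step σ (<⇒≤ (m%n<n r (suc L)))) (≤-reflexive partial≡0))
      rotation-trivial : ∀ j → (j + r) % suc L ≡ j % suc L
      rotation-trivial j = begin
        (j + r) % suc L            ≡⟨ %-distribˡ-+ j r (suc L) ⟩
        (j % suc L + k) % suc L    ≡⟨ cong (λ z → (j % suc L + z) % suc L) k≡0 ⟩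
        (j % suc L + 0) % suc L    ≡⟨ cong (_% suc L) (+-identityʳ (j % suc L)) ⟩
        j % suc L % suc L          ≡⟨ m%n%n≡m%n j (suc L) ⟩
        j % suc L                  ∎
      step≡ : ∀ i → i < suc L → step σ i ≡ step τ i
      step≡ i i<L = begin
        step σ i                       ≡⟨ cong (step σ) (m<n⇒m%n≡m i<L) ⟨
        step σ (i % suc L)             ≡⟨ stepAt-fromSteps v σ ([m+n]%n≡m%n v n) i ⟨
        stepAt (windOnce v σ) i        ≡⟨ stepAt-cong-% (windOnce v σ) i (i + r) (sym (rotation-trivial i)) ⟩
        stepAt (windOnce v σ) (i + r)  ≡⟨ SameOrbit-stepAt 2<n {windOnce v σ} {windOnce v τ} same i ⟨
        stepAt (windOnce v τ) i        ≡⟨ stepAt-fromSteps v τ ([m+n]%n≡m%n v n) i ⟩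
        step τ (i % suc L)             ≡⟨ cong (step τ) (m<n⇒m%n≡m i<L) ⟩
        step τ i                       ∎

  visits0⊎jumpsOver0 : ∀ c → ∃ λ j → toℕ (at c (suc j)) ≡ 0 ⊎ (toℕ (at c j) ≡ n ∸ 1 × stepAt c j ≡ 2)
  visits0⊎jumpsOver0 c with upcrossing (lifted c) lifted0<n (len c) n≤lifted-len
    where
      lifted0<n = ≤-trans (s≤s (≤-reflexive (+-identityʳ (toℕ (at c 0))))) (toℕ<n (at c 0))
      n≤lifted-len = ≤-trans (n≤displacement c) (m≤n+m (displacement c) (toℕ (at c 0)))
  ... | j , lj<n , n≤lj+1 = j , crosses (stepAt∈12 c j)
    where
      lands0 : lifted c (suc j) ≤ n → toℕ (at c (suc j)) ≡ 0
      lands0 lj+1≤n = trans (toℕ-at c (suc j)) (trans (cong (_% n) (≤-antisym lj+1≤n n≤lj+1)) (n%n≡0 n))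
      crosses : stepAt c j ≡ 1 ⊎ stepAt c j ≡ 2 → toℕ (at c (suc j)) ≡ 0 ⊎ (toℕ (at c j) ≡ n ∸ 1 × stepAt c j ≡ 2)
      crosses (inj₁ st≡1) = inj₁ (lands0 (≤-trans (≤-reflexive (trans (lifted-suc c j)
                                 (trans (cong (lifted c j +_) st≡1) (+-comm (lifted c j) 1)))) lj<n))
      crosses (inj₂ st≡2) with m≤n⇒m<n∨m≡n lj<n
      ... | inj₁ lj+1<n = inj₁ (lands0 (≤-trans (≤-reflexive (trans (lifted-suc c j)
                                 (trans (cong (lifted c j +_) st≡2) (+-comm (lifted c j) 2)))) lj+1<n))
      ... | inj₂ lj+1≡n = inj₂ (trans (toℕ-at c j) (trans (m<n⇒m%n≡m lj<n) (cong (_∸ 1) lj+1≡n)) , st≡2)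

  SameOrbit-windOnce : ∀ c → displacement c ≡ n → ∀ r {v} → v < n → toℕ (at c r) ≡ v →
                       Σ (Steps (len c) n) λ σ → step σ 0 ≡ stepAt c r × SameOrbit c (windOnce v σ)
  SameOrbit-windOnce c D≡n r {v} v<n cr≡v
    with s , σ , step≡ ← tabulateSteps (len c) (λ i → stepAt c (i + r)) (λ i _ → stepAt∈12 c (i + r)) =
    build σ step≡ (trans (sym (sumBelow-step σ))
                    (trans (sumBelow-cong (len c) step≡) (trans (displacement-shift c r) D≡n)))
    where
      build : ∀ {s} (σ : Steps (len c) s) → (∀ i → i < len c → step σ i ≡ stepAt c (i + r)) → s ≡ n →
              Σ (Steps (len c) n) λ σ → step σ 0 ≡ stepAt c r × SameOrbit c (windOnce v σ)
      build σ step≡ refl = σ , step≡ 0 z<s , SameOrbit-byShift c (windOnce v σ) r refl shifted start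
        where
          L = len c
          shifted : ∀ j → stepAt (windOnce v σ) j ≡ stepAt c (j + r)
          shifted j = begin
            stepAt (windOnce v σ) j  ≡⟨ stepAt-fromSteps v σ ([m+n]%n≡m%n v n) j ⟩
            step σ (j % L)           ≡⟨ step≡ (j % L) (m%n<n j L) ⟩
            stepAt c (j % L + r)     ≡⟨ stepAt-cong-% c (j % L + r) (j + r) ([m%d+n]%d≡[m+n]%d j r) ⟩
            stepAt c (j + r)         ∎
          start : toℕ (at (windOnce v σ) 0) ≡ toℕ (at c r)
          start = begin
            toℕ (at (windOnce v σ) 0)  ≡⟨ toℕ-at-fromSteps v σ ([m+n]%n≡m%n v n) 0 ⟩
            (v + 0) % n                ≡⟨ cong (_% n) (+-identityʳ v) ⟩
            v % n                      ≡⟨ m<n⇒m%n≡m v<n ⟩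
            v                          ≡⟨ cr≡v ⟨
            toℕ (at c r)               ∎

  windOnce-avoids0 : 1 < n → ∀ {L} (σ : Steps (suc L) n) → step σ 0 ≡ 2 →
                     ∀ j → toℕ (at (windOnce (n ∸ 1) σ) j) ≢ 0
  windOnce-avoids0 1<n {L} σ σ0≡2 j at≡0 =
    sumBelow≢1 σ σ0≡2 k ([m+n]%d≡[m+o]%d⇒n≡o (n ∸ 1) (sumBelow-step< σ (m%n<n j (suc L))) 1<n (begin
      (n ∸ 1 + sumBelow (step σ) k) % n  ≡⟨ toℕ-at-fromSteps (n ∸ 1) σ ([m+n]%n≡m%n (n ∸ 1) n) j ⟨
      toℕ (at (windOnce (n ∸ 1) σ) j)    ≡⟨ at≡0 ⟩
      0                                  ≡⟨ n%n≡0 n ⟨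
      n % n                              ≡⟨ cong (_% n) (m∸n+n≡m (<⇒≤ 1<n)) ⟨
      (n ∸ 1 + 1) % n                    ∎))
    where k = j % suc L

  windOnce0≁windOnce[n∸1] : 1 < n → ∀ {L} (σ τ : Steps (suc L) n) → step τ 0 ≡ 2 →
                            ¬ SameOrbit (windOnce 0 σ) (windOnce (n ∸ 1) τ)
  windOnce0≁windOnce[n∸1] 1<n σ τ τ0≡2 same
    with _ , r , σ≡τ+r ← SameOrbit-sym {windOnce 0 σ} {windOnce (n ∸ 1) τ} same =
    windOnce-avoids0 1<n τ τ0≡2 r (trans (cong toℕ (sym (σ≡τ+r 0)))
      (trans (toℕ-at-fromSteps 0 σ ([m+n]%n≡m%n 0 n) 0) (m<n⇒m%n≡m (>-nonZero⁻¹ n))))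

  windsOnce-normalForm : 1 < n → ∀ c → displacement c ≡ n →
      (Σ (Steps (len c) n) λ σ → SameOrbit c (windOnce 0 σ))
    ⊎ (Σ (Steps (len c) n) λ σ → step σ 0 ≡ 2 × SameOrbit c (windOnce (n ∸ 1) σ))
  windsOnce-normalForm 1<n c D≡n with visits0⊎jumpsOver0 c
  ... | j , inj₁ at≡0
    with σ , _ , same ← SameOrbit-windOnce c D≡n (suc j) (>-nonZero⁻¹ n) at≡0 =
    inj₁ (σ , same)
  ... | j , inj₂ (at≡n-1 , st≡2)
    with σ , σ0≡ , same ← SameOrbit-windOnce c D≡n j (∸-monoʳ-< z<s (<⇒≤ 1<n)) at≡n-1 =
    inj₂ (σ , trans σ0≡ st≡2 , same)

  module _ {c : Circuit n} (all2 : ∀ j → stepAt c j ≡ 2) where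

    toℕ-at-+ : ∀ r t → toℕ (at c (r + t)) ≡ (toℕ (at c r) + double t) % n
    toℕ-at-+ r zero    = trans (cong (toℕ ∘ at c) (+-identityʳ r)) (toℕ≡[toℕ+0]%n (at c r))
    toℕ-at-+ r (suc t) = begin
      toℕ (at c (r + suc t))                       ≡⟨ cong (toℕ ∘ at c) (+-suc r t) ⟩
      toℕ (at c (suc (r + t)))                     ≡⟨ toℕ-at-suc c (r + t) ⟩
      (toℕ (at c (r + t)) + stepAt c (r + t)) % n  ≡⟨ cong₂ (λ a b → (a + b) % n) (toℕ-at-+ r t) (all2 (r + t)) ⟩
      ((a + double t) % n + 2) % n                 ≡⟨ [m%d+n]%d≡[m+n]%d (a + double t) 2 ⟩
      (a + double t + 2) % n
        ≡⟨ cong (_% n) (trans (+-assoc a (double t) 2) (cong (a +_) (+-comm (double t) 2))) ⟩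
      (a + double (suc t)) % n                     ∎
      where a = toℕ (at c r)

    visits0⊎1 : 1 < n → ∃ λ r → toℕ (at c r) ≡ 0 ⊎ toℕ (at c r) ≡ 1
    visits0⊎1 1<n with visits0⊎jumpsOver0 c
    ... | j , inj₁ at≡0 = suc j , inj₁ at≡0
    ... | j , inj₂ (at≡n-1 , _) = suc j , inj₂ (begin
      toℕ (at c (suc j))               ≡⟨ toℕ-at-suc c j ⟩
      (toℕ (at c j) + stepAt c j) % n  ≡⟨ cong₂ (λ a b → (a + b) % n) at≡n-1 (all2 j) ⟩
      (n ∸ 1 + 2) % n                  ≡⟨ cong (_% n) (trans (+-suc (n ∸ 1) 1) (cong suc (m∸n+n≡m (<⇒≤ 1<n)))) ⟩
      (1 + n) % n                      ≡⟨ [m+n]%n≡m%n 1 n ⟩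
      1 % n                            ≡⟨ m<n⇒m%n≡m 1<n ⟩
      1                                ∎)

    SameOrbit-allTwo : ∀ d → (∀ j → stepAt d j ≡ 2) → len c ≡ len d → ∀ r → toℕ (at d 0) ≡ toℕ (at c r) →
                       SameOrbit c d
    SameOrbit-allTwo d all2′ lc≡ld r = SameOrbit-byShift c d r lc≡ld (λ j → trans (all2′ j) (sym (all2 (j + r))))

  stepAt-fromSteps-allTwos : ∀ {m} v closes j → stepAt (fromSteps v (allTwos (suc m)) closes) j ≡ 2
  stepAt-fromSteps-allTwos {m} v closes j =
    trans (stepAt-fromSteps v (allTwos (suc m)) closes j) (step-allTwos (suc m) (m%n<n j (suc m)))

-- Pseudo orbits

module _ {n : ℕ} .{{_ : NonZero n}} where

  orbitSetoid : Setoid 0ℓ 0ℓ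
  orbitSetoid = record
    { Carrier = Circuit n
    ; _≈_ = SameOrbit
    ; isEquivalence = record
      { refl  = λ {c} → SameOrbit-refl {c = c}
      ; sym   = λ {c} {d} → SameOrbit-sym {c = c} {d}
      ; trans = λ {c} {d} {e} → SameOrbit-trans {c = c} {d} {e}
      }
    }

  open PermutationProperties orbitSetoid using (∈-resp-↭)

  SamePseudoOrbit-[_] : ∀ {c d : Circuit n} → SameOrbit c d → SamePseudoOrbit [ c ] [ d ]
  SamePseudoOrbit-[ c≈d ] = Permutation.refl (c≈d ∷ [])

  SamePseudoOrbit-[]⁻ : ∀ {c d : Circuit n} → SamePseudoOrbit [ c ] [ d ] → SameOrbit c d
  SamePseudoOrbit-[]⁻ {c} p with here c≈d ← ∈-resp-↭ {x = c} p (here (SameOrbit-refl {c = c})) = c≈d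

  PrimitivePseudoOrbit-[_] : ∀ {c : Circuit n} → PrimitiveOrbit c → PrimitivePseudoOrbit [ c ]
  PrimitivePseudoOrbit-[ prim ] = prim ∷ [] , [] ∷ []

  NumPrimPseudoOrbits-singletons : ∀ {l} (cs : List (Circuit n)) →
      All (λ c → PrimitiveOrbit c × len c ≡ l) cs → AllPairs (λ c d → ¬ SameOrbit c d) cs →
      (∀ γ → PrimitivePseudoOrbit γ → pseudoLength γ ≡ l → ∃ λ c → γ ≡ [ c ] × Any (SameOrbit c) cs) →
      NumPrimPseudoOrbits l (length cs)
  NumPrimPseudoOrbits-singletons cs good distinct complete =
      map [_] cs
    , length-map [_] cs
    , All.map⁺ (All.map (λ (prim , len≡l) → PrimitivePseudoOrbit-[ prim ] , trans (+-identityʳ _) len≡l) good)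
    , AllPairs.map⁺ (AllPairs.map (λ c≉d → c≉d ∘ SamePseudoOrbit-[]⁻) distinct)
    , λ γ prim len≡l → represented (complete γ prim len≡l)
    where
      represented : ∀ {γ} → (∃ λ c → γ ≡ [ c ] × Any (SameOrbit c) cs) → Any (SamePseudoOrbit γ) (map [_] cs)
      represented (c , refl , c∈cs) = Any.map⁺ (Any.map SamePseudoOrbit-[_] c∈cs)

  n≤pseudoLength : ∀ c d γ → n ≤ pseudoLength (c ∷ d ∷ γ)
  n≤pseudoLength c d γ = ≤-trans (halves≤ (n≤double-len c) (n≤double-len d)) (+-monoʳ-≤ (len c) (m≤m+n (len d) _))

-- Counting

module Order3+ (k : ℕ) where

  n : ℕ
  n = 3 + k

  1<n : 1 < n
  1<n = s<s z<s

  2<n : 2 < n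
  2<n = s<s (s<s z<s)

  open PermutationProperties (orbitSetoid {n}) using (xs↭ys⇒|xs|≡|ys|)

  module ShortLength (l′ : ℕ) (l<n : suc l′ < n) where

    l′≤1+k : l′ ≤ suc k
    l′≤1+k = s≤s⁻¹ (s≤s⁻¹ l<n)

    -- Orbits winding once, rotated to start at 0, or at n − 1 for those jumping over 0.
    through0 : List (Circuit n)
    through0 = map (windOnce 0) (allSteps (suc l′) n)

    over0 : List (Circuit n)
    over0 = map (windOnce (n ∸ 1) ∘ 2∷_) (allSteps l′ (suc k))

    representatives : List (Circuit n)
    representatives = through0 ++ over0

    length-representatives : length representatives ≡ suc l′ C (n ∸ suc l′) + l′ C (suc k ∸ l′)
    length-representatives = trans (length-++ through0) (cong₂ _+_
      (trans (length-map (windOnce 0) (allSteps (suc l′) n)) (length-allSteps (suc l′) n (<⇒≤ l<n)))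
      (trans (length-map (windOnce (n ∸ 1) ∘ 2∷_) (allSteps l′ (suc k))) (length-allSteps l′ (suc k) l′≤1+k)))

    l*count≡n*binomial : suc l′ * length representatives ≡ n * (suc l′ C (n ∸ suc l′))
    l*count≡n*binomial = begin
      suc l′ * length representatives      ≡⟨ cong (suc l′ *_) length-representatives ⟩
      suc l′ * (suc l′ C (n ∸ suc l′) + l′ C b)
        ≡⟨ cong (λ z → suc l′ * (suc l′ C z + l′ C b)) n-l≡1+b ⟩
      suc l′ * (suc l′ C suc b + l′ C b)   ≡⟨ absorption-+ l′ b ⟩
      (suc l′ + suc b) * (suc l′ C suc b)  ≡⟨ cong₂ (λ u z → u * (suc l′ C z)) l+[n-l]≡n (sym n-l≡1+b) ⟩
      n * (suc l′ C (n ∸ suc l′))          ∎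
      where
        b = suc k ∸ l′
        n-l≡1+b : n ∸ suc l′ ≡ suc b
        n-l≡1+b = +-∸-assoc 1 l′≤1+k
        l+[n-l]≡n : suc l′ + suc b ≡ n
        l+[n-l]≡n = cong suc (trans (+-suc l′ b) (cong suc (m+[n∸m]≡n l′≤1+k)))

    representatives-primitive : All (λ c → PrimitiveOrbit c × len c ≡ suc l′) representatives
    representatives-primitive = All.++⁺
      (All.map⁺ {xs = allSteps (suc l′) n} (All.tabulate (λ {σ} _ → windOnce-primitive 0 σ , refl)))
      (All.map⁺ {xs = allSteps l′ (suc k)} (All.tabulate (λ {τ} _ → windOnce-primitive (n ∸ 1) (2∷ τ) , refl)))

    through0-distinct : AllPairs (λ c d → ¬ SameOrbit c d) through0
    through0-distinct = AllPairs.map⁺ {xs = allSteps (suc l′) n}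
      (AllPairs.map (λ σ≢τ → σ≢τ ∘ windOnce-injective 2<n 0 _ _) (allSteps-unique (suc l′) n))

    over0-distinct : AllPairs (λ c d → ¬ SameOrbit c d) over0
    over0-distinct = AllPairs.map⁺ {xs = allSteps l′ (suc k)}
      (AllPairs.map (λ σ≢τ → σ≢τ ∘ 2∷-injective ∘ windOnce-injective 2<n (n ∸ 1) _ _) (allSteps-unique l′ (suc k)))

    through0≁over0 : All (λ c → All (λ d → ¬ SameOrbit c d) over0) through0
    through0≁over0 = All.map⁺ {xs = allSteps (suc l′) n} (All.tabulate λ {σ} _ →
      All.map⁺ {xs = allSteps l′ (suc k)} (All.tabulate λ {τ} _ → windOnce0≁windOnce[n∸1] 1<n σ (2∷ τ) refl))

    through0-complete : ∀ c {L} (σ : Steps (suc L) n) → L ≡ l′ → SameOrbit c (windOnce 0 σ) →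
                        Any (SameOrbit c) representatives
    through0-complete c σ refl same = Any.++⁺ˡ (Any.map⁺ (Any.map (λ { refl → same }) (∈-allSteps σ)))

    over0-complete : ∀ c {L} (σ : Steps (suc L) n) → step σ 0 ≡ 2 → L ≡ l′ →
                     SameOrbit c (windOnce (n ∸ 1) σ) → Any (SameOrbit c) representatives
    over0-complete c (2∷ τ) _ refl same = Any.++⁺ʳ through0 (Any.map⁺ (Any.map (λ { refl → same }) (∈-allSteps τ)))

    represented : ∀ c → len-1 c ≡ l′ → Any (SameOrbit c) representatives
    represented c len≡l
      with windsOnce-normalForm 1<n c (displacement≡n c (≤-trans (s<s (s<s (≤-reflexive len≡l))) l<n))
    ... | inj₁ (σ , same)         = through0-complete c σ len≡l same
    ... | inj₂ (σ , σ0≡2 , same) = over0-complete c σ σ0≡2 len≡l same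

    representatives-complete : ∀ γ → PrimitivePseudoOrbit γ → pseudoLength γ ≡ suc l′ →
                               ∃ λ c → γ ≡ [ c ] × Any (SameOrbit c) representatives
    representatives-complete (c ∷ [])    _ len≡l =
      c , refl , represented c (suc-injective (trans (sym (+-identityʳ (len c))) len≡l))
    representatives-complete (c ∷ d ∷ γ) _ len≡l =
      contradiction (≤-trans (n≤pseudoLength c d γ) (≤-reflexive len≡l)) (<⇒≱ l<n)

    count : NumPrimPseudoOrbits {n} (suc l′) (length representatives)
    count = NumPrimPseudoOrbits-singletons representatives representatives-primitive
              (AllPairs.++⁺ through0-distinct over0-distinct through0≁over0) representatives-complete

  module FullLength where

    unitLoop : Circuit n
    unitLoop = windOnce 0 (allOnes n)

    stepAt-unitLoop : ∀ j → stepAt unitLoop j ≡ 1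
    stepAt-unitLoop j = trans (stepAt-fromSteps {n} 0 (allOnes n) _ j) (step-allOnes n (m%n<n j n))

    SameOrbit-unitLoop : ∀ c → len c ≡ n → displacement c ≡ n → SameOrbit c unitLoop
    SameOrbit-unitLoop c len≡n D≡n with windsOnce-normalForm 1<n c D≡n
    ... | inj₁ (σ , same)     = toUnit σ (suc-injective len≡n) same
      where
        toUnit : ∀ {L} (σ : Steps (suc L) n) → L ≡ 2 + k → SameOrbit c (windOnce 0 σ) → SameOrbit c unitLoop
        toUnit σ refl = subst (SameOrbit c ∘ windOnce 0) (Steps-L-L≡allOnes σ)
    ... | inj₂ (σ , σ0≡2 , _) = contradiction (trans (sym (firstStep σ (suc-injective len≡n))) σ0≡2) λ ()
      where
        firstStep : ∀ {L} (σ : Steps (suc L) n) → L ≡ 2 + k → step σ 0 ≡ 1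
        firstStep σ refl = cong (λ τ → step τ 0) (Steps-L-L≡allOnes σ)

    unitLoop⊎allTwo : ∀ c → len c ≡ n → SameOrbit c unitLoop ⊎ (∀ j → stepAt c j ≡ 2)
    unitLoop⊎allTwo c len≡n with displacement≡n⊎n+n c (≤-reflexive len≡n)
    ... | inj₁ D≡n   = inj₁ (SameOrbit-unitLoop c len≡n D≡n)
    ... | inj₂ D≡n+n =
      inj₂ (displacement≡double⇒stepAt≡2 c (trans D≡n+n (sym (trans (cong double len≡n) (double≡m+m n)))))

    module Even (m : ℕ) (2m+2≡n : double (suc m) ≡ n) where

      closes : ∀ v → (v + double (suc m)) % n ≡ v % n
      closes v = trans (cong (λ z → (v + z) % n) 2m+2≡n) ([m+n]%n≡m%n v n)

      halfLoop : ℕ → Circuit n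
      halfLoop v = fromSteps v (allTwos (suc m)) (closes v)

      toℕ-at-halfLoop : ∀ v r → toℕ (at (halfLoop v) r) ≡ (v + double (r % suc m)) % n
      toℕ-at-halfLoop v r = trans (toℕ-at-fromSteps {n} v (allTwos (suc m)) (closes v) r)
        (cong (λ z → (v + z) % n) (sumBelow-allTwos (suc m) (<⇒≤ (m%n<n r (suc m)))))

      stepAt-halfLoop : ∀ v j → stepAt (halfLoop v) j ≡ 2
      stepAt-halfLoop v = stepAt-fromSteps-allTwos {n} v (closes v)

      halfLoop-primitive : ∀ v → PrimitiveOrbit (halfLoop v)
      halfLoop-primitive v = fromSteps-primitive v (allTwos (suc m)) (closes v) (≤-reflexive 2m+2≡n)

      halfLoop0≁halfLoop1 : ¬ SameOrbit (halfLoop 0) (halfLoop 1)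
      halfLoop0≁halfLoop1 (_ , r , at≡) = double≢1+double x 0 (sym (begin
        1                        ≡⟨ toℕ-at-halfLoop 1 0 ⟨
        toℕ (at (halfLoop 1) 0)  ≡⟨ cong toℕ (at≡ 0) ⟩
        toℕ (at (halfLoop 0) r)  ≡⟨ toℕ-at-halfLoop 0 r ⟩
        double x % n             ≡⟨ m<n⇒m%n≡m (≤-trans (double-<-mono (m%n<n r (suc m))) (≤-reflexive 2m+2≡n)) ⟩
        double x                 ∎))
        where x = r % suc m

      allTwo-halfLength : ∀ c → len c ≡ suc m → (∀ j → stepAt c j ≡ 2) →
                          SameOrbit c (halfLoop 0) ⊎ SameOrbit c (halfLoop 1)
      allTwo-halfLength c len≡ all2 with visits0⊎1 {c = c} all2 1<n
      ... | r , inj₁ at≡0 = inj₁ (SameOrbit-allTwo {c = c} all2 (halfLoop 0) (stepAt-halfLoop 0) len≡ r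
                                    (trans (toℕ-at-halfLoop 0 0) (sym at≡0)))
      ... | r , inj₂ at≡1 = inj₂ (SameOrbit-allTwo {c = c} all2 (halfLoop 1) (stepAt-halfLoop 1) len≡ r
                                    (trans (toℕ-at-halfLoop 1 0) (sym at≡1)))

      allTwo-fullLength-repetition : ∀ c → len c ≡ n → (∀ j → stepAt c j ≡ 2) → IsRepetition c
      allTwo-fullLength-repetition c len≡n all2 =
        halfLoop v₀ , 1+m<len , divides 2 len≡2*[1+m] , λ j → toℕ-injective
          (%-recurrence-unique (toℕ ∘ at c) (toℕ ∘ at (halfLoop v₀)) (λ _ → 2)
            (trans (toℕ≡[toℕ+0]%n (at c 0)) (sym (toℕ-at-halfLoop v₀ 0)))
            (λ j → trans (toℕ-at-suc c j) (cong (λ z → (toℕ (at c j) + z) % n) (all2 j)))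
            (λ j → trans (toℕ-at-suc (halfLoop v₀) j)
                         (cong (λ z → (toℕ (at (halfLoop v₀) j) + z) % n) (stepAt-halfLoop v₀ j)))
            j)
        where
          v₀ = toℕ (at c 0)
          len≡2+2m : len c ≡ suc m + suc m
          len≡2+2m = trans len≡n (trans (sym 2m+2≡n) (double≡m+m (suc m)))
          1+m<len : suc m < len c
          1+m<len = ≤-trans (m<m+n (suc m) z<s) (≤-reflexive (sym len≡2+2m))
          len≡2*[1+m] : len c ≡ 2 * suc m
          len≡2*[1+m] = trans len≡2+2m (cong (suc m +_) (sym (+-identityʳ (suc m))))

      pseudoOrbits : List PseudoOrbit
      pseudoOrbits = [ unitLoop ] ∷ (halfLoop 0 ∷ halfLoop 1 ∷ []) ∷ []

      single-complete : ∀ c → PrimitiveOrbit c → len c ≡ n → Any (SamePseudoOrbit [ c ]) pseudoOrbits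
      single-complete c prim len≡n with unitLoop⊎allTwo c len≡n
      ... | inj₁ c≈unitLoop = here SamePseudoOrbit-[ c≈unitLoop ]
      ... | inj₂ all2       = contradiction (allTwo-fullLength-repetition c len≡n all2) prim

      pair-complete : ∀ c d → ¬ SameOrbit c d → len c ≡ suc m → len d ≡ suc m →
                      (∀ j → stepAt c j ≡ 2) → (∀ j → stepAt d j ≡ 2) →
                      Any (SamePseudoOrbit (c ∷ d ∷ [])) pseudoOrbits
      pair-complete c d c≁d len-c len-d all2-c all2-d
        with allTwo-halfLength c len-c all2-c | allTwo-halfLength d len-d all2-d
      ... | inj₁ c≈h0 | inj₂ d≈h1 = there (here (Permutation.refl (c≈h0 ∷ d≈h1 ∷ [])))
      ... | inj₂ c≈h1 | inj₁ d≈h0 = there (here (Permutation.swap c≈h1 d≈h0 (Permutation.refl [])))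
      ... | inj₁ c≈h0 | inj₁ d≈h0 =
        contradiction (SameOrbit-trans {c = c} {halfLoop 0} {d} c≈h0 (SameOrbit-sym {c = d} {halfLoop 0} d≈h0)) c≁d
      ... | inj₂ c≈h1 | inj₂ d≈h1 =
        contradiction (SameOrbit-trans {c = c} {halfLoop 1} {d} c≈h1 (SameOrbit-sym {c = d} {halfLoop 1} d≈h1)) c≁d

      complete : ∀ γ → PrimitivePseudoOrbit γ → pseudoLength γ ≡ n → Any (SamePseudoOrbit γ) pseudoOrbits
      complete (c ∷ []) ((prim ∷ []) , _) len≡n = single-complete c prim (trans (sym (+-identityʳ (len c))) len≡n)
      complete (c ∷ d ∷ []) (_ , ((c≁d ∷ []) ∷ _)) len≡n
        with 2c≡n , 2d≡n , _ ← halves-tight (n≤double-len c) (n≤double-len d) (≤-reflexive len≡n) =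
        pair-complete c d c≁d (half 2c≡n) (half 2d≡n)
          (double-len≤n⇒stepAt≡2 c (≤-reflexive 2c≡n)) (double-len≤n⇒stepAt≡2 d (≤-reflexive 2d≡n))
        where
          half : ∀ {a} → double a ≡ n → a ≡ suc m
          half 2a≡n = double-injective (trans 2a≡n (sym 2m+2≡n))
      complete (c ∷ d ∷ e ∷ γ) _ len≡n =
        contradiction (proj₂ (proj₂ (halves-tight (n≤double-len c) (n≤double-len d) (≤-reflexive len≡n)))) λ ()

      count : NumPrimPseudoOrbits {n} n 2
      count = pseudoOrbits , refl , good , distinct , complete
        where
          good : All (λ γ → PrimitivePseudoOrbit γ × pseudoLength γ ≡ n) pseudoOrbits
          good = (PrimitivePseudoOrbit-[ windOnce-primitive 0 (allOnes n) ] , +-identityʳ n)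
               ∷ ((halfLoop-primitive 0 ∷ halfLoop-primitive 1 ∷ [] , (halfLoop0≁halfLoop1 ∷ []) ∷ [] ∷ [])
                 , trans (cong (suc m +_) (+-identityʳ (suc m))) (trans (sym (double≡m+m (suc m))) 2m+2≡n))
               ∷ []
          distinct : AllPairs (λ γ δ → ¬ SamePseudoOrbit γ δ) pseudoOrbits
          distinct = ((λ p → contradiction (xs↭ys⇒|xs|≡|ys| p) λ ()) ∷ []) ∷ [] ∷ []

    module Odd (m : ℕ) (2m+1≡n : suc (double m) ≡ n) where

      closes : (0 + double n) % n ≡ 0 % n
      closes = trans (cong (_% n) (double≡m+m n)) (trans ([m+n]%n≡m%n n n) (n%n≡0 n))

      twoLoop : Circuit n
      twoLoop = fromSteps 0 (allTwos n) closes

      toℕ-at-twoLoop : ∀ {j} → j < n → toℕ (at twoLoop j) ≡ double j % n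
      toℕ-at-twoLoop {j} j<n = trans (toℕ-at-fromSteps {n} 0 (allTwos n) closes j)
        (cong (_% n) (trans (cong (sumBelow (step (allTwos n))) (m<n⇒m%n≡m j<n)) (sumBelow-allTwos n (<⇒≤ j<n))))

      stepAt-twoLoop : ∀ j → stepAt twoLoop j ≡ 2
      stepAt-twoLoop = stepAt-fromSteps-allTwos {n} {m = 2 + k} 0 closes

      -- A shorter period p would give 2p ≡ 0 modulo n with 0 < p < n, so 2p = n, but n is odd.
      twoLoop-primitive : PrimitiveOrbit twoLoop
      twoLoop-primitive (c′ , p<n , _ , at≡) with %≡0⇒≡0⊎≡d⊎≡d+d (double (len c′)) 2p%n≡0 2p≤n+n
        where
          2p%n≡0 : double (len c′) % n ≡ 0
          2p%n≡0 = trans (sym (toℕ-at-twoLoop p<n))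
                         (cong toℕ (trans (at≡ (len c′)) (trans (at-len c′) (sym (at≡ 0)))))
          2p≤n+n = ≤-trans (double-mono-≤ (<⇒≤ p<n)) (≤-reflexive (double≡m+m n))
      ... | inj₁ ()
      ... | inj₂ (inj₁ 2p≡n)   = double≢1+double (len c′) m (trans 2p≡n (sym 2m+1≡n))
      ... | inj₂ (inj₂ 2p≡n+n) = <-irrefl (double-injective (trans 2p≡n+n (sym (double≡m+m n)))) p<n

      unitLoop≁twoLoop : ¬ SameOrbit unitLoop twoLoop
      unitLoop≁twoLoop same@(_ , r , _) = contradiction (begin
        2                  ≡⟨ stepAt-twoLoop 0 ⟨
        stepAt twoLoop 0   ≡⟨ SameOrbit-stepAt 2<n {unitLoop} {twoLoop} same 0 ⟩
        stepAt unitLoop r  ≡⟨ stepAt-unitLoop r ⟩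
        1                  ∎) λ ()

      SameOrbit-twoLoop : ∀ c → len c ≡ n → (∀ j → stepAt c j ≡ 2) → SameOrbit c twoLoop
      SameOrbit-twoLoop c len≡n all2 with visits0⊎1 {c = c} all2 1<n
      ... | r , inj₁ at≡0 = SameOrbit-allTwo {c = c} all2 twoLoop stepAt-twoLoop len≡n r (sym at≡0)
      ... | r , inj₂ at≡1 = SameOrbit-allTwo {c = c} all2 twoLoop stepAt-twoLoop len≡n (r + m) (sym (begin
        toℕ (at c (r + m))             ≡⟨ toℕ-at-+ {c = c} all2 r m ⟩
        (toℕ (at c r) + double m) % n  ≡⟨ cong (λ z → (z + double m) % n) at≡1 ⟩
        suc (double m) % n             ≡⟨ cong (_% n) 2m+1≡n ⟩
        n % n                          ≡⟨ n%n≡0 n ⟩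
        0                              ∎))

      complete : ∀ γ → PrimitivePseudoOrbit γ → pseudoLength γ ≡ n →
                 ∃ λ c → γ ≡ [ c ] × Any (SameOrbit c) (unitLoop ∷ twoLoop ∷ [])
      complete (c ∷ []) _ len≡n = c , refl , single-complete (trans (sym (+-identityʳ (len c))) len≡n)
        where
          single-complete : len c ≡ n → Any (SameOrbit c) (unitLoop ∷ twoLoop ∷ [])
          single-complete len-c≡n with unitLoop⊎allTwo c len-c≡n
          ... | inj₁ c≈unitLoop = here c≈unitLoop
          ... | inj₂ all2       = there (here (SameOrbit-twoLoop c len-c≡n all2))
      complete (c ∷ d ∷ γ) _ len≡n =
        contradiction (trans (proj₁ (halves-tight (n≤double-len c) (n≤double-len d) (≤-reflexive len≡n)))
                             (sym 2m+1≡n))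
                      (double≢1+double (len c) m)

      count : NumPrimPseudoOrbits {n} n 2
      count = NumPrimPseudoOrbits-singletons (unitLoop ∷ twoLoop ∷ [])
        ((windOnce-primitive 0 (allOnes n) , refl) ∷ (twoLoop-primitive , refl) ∷ [])
        ((unitLoop≁twoLoop ∷ []) ∷ [] ∷ [])
        complete

    count : NumPrimPseudoOrbits {n} n 2
    count with even⊎odd n
    ... | inj₁ (suc m , n≡2m+2) = Even.count m (sym n≡2m+2)
    ... | inj₂ (m , n≡2m+1)     = Odd.count m (sym n≡2m+1)

proposition3 : (n : ℕ) .{{_ : NonZero n}} → n > 2 → (l : ℕ) → 0 < l → l ≤ n →
    ∃ λ N → NumPrimPseudoOrbits {n} l N
    × (l < n → l * N ≡ n * (l C (n ∸ l)))
    × (l ≡ n → N ≡ 2)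
proposition3 (suc zero)          (s≤s ())
proposition3 (suc (suc zero))    (s≤s (s≤s ()))
proposition3 (suc (suc (suc k))) _ (suc l′) _ l≤n with suc l′ <? 3 + k
... | yes l<n = length representatives , count , (λ _ → l*count≡n*binomial) , (λ l≡n → contradiction l≡n (<⇒≢ l<n))
  where open Order3+.ShortLength k l′ l<n
... | no  l≮n with refl ← ≤-antisym l≤n (≮⇒≥ l≮n) =
  2 , count , (λ l<n → contradiction l<n (<-irrefl refl)) , λ _ → refl
  where open Order3+.FullLength k
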